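{- (i) Let $(A,\le)$ be a poset and $B\subseteq A$ carry the restriction of $\le$. Then for every $e\in B$, the induced order $\le_e$ on $B_e^*$ (computed from the poset $B$) coincides with the restriction to $B_e^*\subseteq A_e^*$ of the induced order $\le_e$ on $A_e^*$ (computed from the poset $A$); that is, $(B_e^*,\le_e)$ is a subposet of $(A_e^*,\le_e)$. (ii) Let $\le'$ and $\le$ be partial orders on a set $A$ such that $\le'$ is a suborder of $\le$ (i.e. $x\le' y$ implies $x\le y$). Then for every $a\in A$, the induced order $\le'_a$ on $A_a^*$ is a suborder of the induced order $\le_a$ on $A_a^*$, i.e. $v\le'_a w$ implies $v\le_a w$.
   Context: All order relations are reflexive. For a set $X$, $X^*$ is the free monoid of finite words over $X$; $|w|$ is the length and $w_i$ the $i$-th letter of a word $w$. For a poset $(P,\le)$ and $p\in P$, $P_p^*=(P\setminus\{p\})^*$; a word $w'\in P^*$ is a $p$-extension of $w\in P_p^*$ if $w'$ is obtained from $w$ by inserting finitely many (possibly zero) copies of $p$ at arbitrary positions. The induced order on $P_p^*$: $v\le_p w$ iff there exist $p$-extensions $v'$ of $v$ and $w'$ of $w$ with $|v'|=|w'|=n$ and $v'_i\le w'_i$ in $P$ for all $i=1,\dots,n$. -}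

module Defs where

open import Level using (Level; _⊔_)
open import Data.List using (List; []; _∷_; map)
open import Data.List.Relation.Unary.All using (All)
open import Data.List.Relation.Binary.Pointwise using (Pointwise)
open import Data.Product using (Σ; ∃; ∃-syntax; _×_; proj₁)
open import Relation.Binary.Core using (Rel)
open import Relation.Binary.Structures using (IsPartialOrder)
open import Relation.Binary.PropositionalEquality using (_≡_; _≢_)

private
  variable
    a ℓ : Level

-- Words over X: List X.  The set P_p^* = (P \ {p})^* is represented by
-- words w : List P together with a proof  All (_≢ p) w.
NoOcc : {A : Set a} → A → List A → Set a
NoOcc p w = All (_≢ p) w

data Ext {A : Set a} (p : A) : List A → List A → Set a where
  []   : Ext p [] []
  keep : ∀ {x w w'} → Ext p w w' → Ext p (x ∷ w) (x ∷ w')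
  ins  : ∀ {w w'} → Ext p w w' → Ext p w (p ∷ w')

-- Induced order ≤_p:  v ≤_p w  iff there are p-extensions v', w' of v, w
-- of equal length n with v'_i ≤ w'_i for all i (Pointwise forces equal length).
InducedLe : {A : Set a} → Rel A ℓ → A → List A → List A → Set (a ⊔ ℓ)
InducedLe _≤_ p v w =
  ∃[ v' ] ∃[ w' ] (Ext p v v' × Ext p w w' × Pointwise _≤_ v' w')

IsPO : {A : Set a} → Rel A ℓ → Set (a ⊔ ℓ)
IsPO _≤_ = IsPartialOrder _≡_ _≤_

Sub : (A : Set a) → (A → Set ℓ) → Set (a ⊔ ℓ)
Sub A P = Σ A P

restrict : {A : Set a} {P : A → Set ℓ} {r : Level} → Rel A r → Rel (Sub A P) r
restrict _≤_ x y = proj₁ x ≤ proj₁ y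

-- A p-extension of a word lifts along any letter map f: inserting f e into
-- map f v is the image of inserting e into v.  So the induced order of the
-- pulled-back relation R (f x) (f y) is the pullback of the induced order of R,
-- which gives (i) with f = proj₁; (ii) holds because Pointwise is monotone.
module Submission where

open import Defs
open import Level using (Level)
open import Data.List using (List; map; []; _∷_)
open import Data.List.Relation.Binary.Pointwise as Pointwise using ([]; _∷_)
open import Data.Product using (∃-syntax; _×_; proj₁; _,_)
open import Function.Bundles using (_⇔_; mk⇔)
open import Relation.Binary.Core using (Rel; _⇒_)
open import Function.Base using (_on_)
open import Relation.Nullary.Irrelevant using (Irrelevant)
open import Relation.Binary.PropositionalEquality using (_≡_; refl)

module _ {a b : Level} {A : Set a} {B : Set b} (f : B → A) where

  Ext-map⁺ : ∀ {e v u} → Ext e v u → Ext (f e) (map f v) (map f u)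
  Ext-map⁺ []       = []
  Ext-map⁺ (keep x) = keep (Ext-map⁺ x)
  Ext-map⁺ (ins x)  = ins (Ext-map⁺ x)

  Ext-map⁻ : ∀ {e} v {u} → Ext (f e) (map f v) u →
             ∃[ u′ ] (Ext e v u′ × map f u′ ≡ u)
  Ext-map⁻ []      []       = [] , [] , refl
  Ext-map⁻ (y ∷ v) (keep x) with Ext-map⁻ v x
  ... | u′ , ext , refl = y ∷ u′ , keep ext , refl
  Ext-map⁻ v       (ins x)  with Ext-map⁻ v x
  ... | u′ , ext , refl = _ ∷ u′ , ins ext , refl

  InducedLe-map : ∀ {ℓ} (R : Rel A ℓ) e v w →
                  InducedLe (R on f) e v w ⇔ InducedLe R (f e) (map f v) (map f w)
  InducedLe-map R e v w = mk⇔ push pull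
    where
    push : InducedLe (R on f) e v w → InducedLe R (f e) (map f v) (map f w)
    push (v′ , w′ , ev , ew , vw) =
      map f v′ , map f w′ , Ext-map⁺ ev , Ext-map⁺ ew , Pointwise.map⁺ f f vw

    pull : InducedLe R (f e) (map f v) (map f w) → InducedLe (R on f) e v w
    pull (_ , _ , ev , ew , vw) with Ext-map⁻ v ev | Ext-map⁻ w ew
    ... | v′ , ev′ , refl | w′ , ew′ , refl =
      v′ , w′ , ev′ , ew′ , Pointwise.map⁻ f f vw

InducedLe-mono : ∀ {a ℓ₁ ℓ₂} {A : Set a} {R : Rel A ℓ₁} {S : Rel A ℓ₂} →
                 R ⇒ S → ∀ p → InducedLe R p ⇒ InducedLe S p
InducedLe-mono R⇒S p (v′ , w′ , ev , ew , vw) =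
  v′ , w′ , ev , ew , Pointwise.map R⇒S vw

mainTheorem7 : ∀ {a ℓ p : Level}
    → (∀ (A : Set a) (_≤_ : Rel A ℓ) → IsPO _≤_
        → (P : A → Set p) → (∀ x → Irrelevant (P x))
        → (e : Sub A P) (v w : List (Sub A P)) → NoOcc e v → NoOcc e w
        → InducedLe (restrict _≤_) e v w ⇔ InducedLe _≤_ (proj₁ e) (map proj₁ v) (map proj₁ w))
    × (∀ (A : Set a) (_≤′_ _≤_ : Rel A ℓ) → IsPO _≤′_ → IsPO _≤_
        → (∀ {x y} → x ≤′ y → x ≤ y)
        → (x : A) (v w : List A) → NoOcc x v → NoOcc x w
        → InducedLe _≤′_ x v w → InducedLe _≤_ x v w)
mainTheorem7 =
    (λ _ _≤_ _ _ _ e v w _ _ → InducedLe-map proj₁ _≤_ e v w)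
  , (λ _ _ _ _ _ ≤′⇒≤ x _ _ _ _ → InducedLe-mono ≤′⇒≤ x)
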